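{- Let $\alpha(k)$ be the largest odd divisor of $k$, let $V(n)=\sum_{k=1}^n\frac{\alpha(k)}{k}$, and define $v(n)=V(n)-\frac{2n}{3}$ for $n\ge1$ and $v(0)=0$. Then: (a) For every positive integer $n$, $v(2n)=\frac12 v(n)$ and $v(2n+1)=\frac13+\frac12 v(n)$. (b) If $n=\sum_{k=0}^m \varepsilon_k 2^k$ with $\varepsilon_k\in\{0,1\}$, then $v(n)=\frac13\sum_{k=0}^m\frac{\varepsilon_k}{2^k}$. In particular, the set $\{v(n):n\ge1\}$ is a dense subset of the interval $[0,\frac23]$. (c) If $n=\sum_{k=0}^m \varepsilon_k 2^k$ with $\varepsilon_k\in\{0,1\}$, then $v(n)+\sum_{p=0}^m v(\lfloor 2^{ -p}n\rfloor)=\frac23\sum_{k=0}^m\varepsilon_k$. (d) (Symmetry) Let $m\ge0$ and $n=2^m+\sum_{k=0}^{m-1}\varepsilon_k2^k$ with $\varepsilon_k\in\{0,1\}$ (so $2^m\le n<2^{m+1}$), and set $\widehat{n}=2^m+\sum_{k=0}^{m-1}(1-\varepsilon_k)2^k$. Then $v(n)+v(\widehat{n})=\frac23$.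
   Context: $\alpha(k)$ is the largest odd divisor of the positive integer $k$. $\lfloor\cdot\rfloor$ is the floor function. -}

module Defs where

open import Data.Nat as ℕ using (ℕ; zero; suc; _+_; _*_; _^_; _⊔_; NonZero)
open import Data.Nat.Properties using (m^n≢0)
open import Data.Nat.Divisibility using (_∣_; _∣?_)
open import Data.Bool using (if_then_else_)
open import Data.Product using (_×_)
open import Data.List using (map; foldr)
open import Data.List.Base using (applyUpTo)
open import Relation.Nullary using (¬_; does)
open import Relation.Nullary.Decidable using (_×-dec_; ¬?)
open import Data.Integer using (+_)
open import Data.Rational using (ℚ; _/_; 0ℚ) renaming (_+_ to _+ℚ_; _-_ to _-ℚ_)

OddDivisor : ℕ → ℕ → Set
OddDivisor d k = d ∣ k × ¬ (2 ∣ d)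

-- α k = the largest odd divisor of k: the maximum of those d ∈ {1,…,k}
-- that are odd divisors of k (for k ≥ 1 the set contains 1; α 0 = 0 is a
-- junk value that is never used).
α : ℕ → ℕ
α k = foldr _⊔_ 0
        (map (λ d → if does (d ∣? k ×-dec ¬? (2 ∣? d)) then d else 0)
             (applyUpTo suc k))

Σ<ℕ : ℕ → (ℕ → ℕ) → ℕ
Σ<ℕ zero    f = 0
Σ<ℕ (suc n) f = Σ<ℕ n f + f n

Σ<ℚ : ℕ → (ℕ → ℚ) → ℚ
Σ<ℚ zero    f = 0ℚ
Σ<ℚ (suc n) f = Σ<ℚ n f +ℚ f n

V : ℕ → ℚ
V zero    = 0ℚ
V (suc n) = V n +ℚ (+ α (suc n)) / suc n

v : ℕ → ℚ
v zero    = 0ℚ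
v (suc n) = V (suc n) -ℚ (+ (2 * suc n)) / 3

-- Since α(2k) = α(k) and α(2k+1) = 2k+1, splitting V(2n) into its odd- and even-indexed
-- summands gives V(2n) = n + V(n)/2, hence v(e + 2n) = e/3 + v(n)/2 for every binary digit e.
-- Everything follows by peeling off the last binary digit: (b), (c) and (d) by induction on
-- the number of digits, the bounds 0 ≤ v ≤ 2/3 by strong induction.  For density, the same
-- recursion shows that every j/(3·2^K) with j < 2^(K+1) is a value of v, and these grid
-- points become arbitrarily fine.

module Submission where

open import Data.Bool using (if_then_else_)
open import Data.Integer as ℤ using (+_; -[1+_])
import Data.Integer.Properties as ℤP
open import Data.List using ([]; _∷_; map; foldr; applyUpTo)
open import Data.List.Membership.Propositional using (_∈_)
open import Data.List.Membership.Propositional.Properties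
  using (∈-map⁺; ∈-map⁻; ∈-applyUpTo⁺; foldr-selective)
open import Data.List.Properties using (foldr-preservesᵒ)
import Data.List.Relation.Unary.Any as Any
open import Data.Nat as ℕ
  using (ℕ; zero; suc; _+_; _*_; _^_; _∸_; _⊔_; _/_; _%_; _≤_; _<_; z≤n; s≤s; NonZero)
open import Data.Nat.Coprimality using (Coprime; coprime-divisor)
open import Data.Nat.Divisibility
  using (_∤_; _∣?_; divides; ∣⇒≤; ∣-trans; ∣-refl; 1∣_; n∣m*n; m∣m*n)
import Data.Nat.DivMod as DM
open import Data.Nat.Induction using (<-rec)
open import Data.Nat.Primality using (Prime; prime[2]; prime⇒irreducible)
import Data.Nat.Properties as ℕP
open import Data.Nat.Properties using (m^n≢0)
import Data.Nat.Tactic.RingSolver as ℕ-Solver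
open import Data.Product using (_×_; _,_; proj₁; proj₂; ∃-syntax)
open import Data.Rational
  using (ℚ; mkℚ; ↥_; ↧_; ½; 0ℚ; 1ℚ; _-_; toℚᵘ; *≤*; *<*)
  renaming (_/_ to _÷_; _+_ to _+ℚ_; _*_ to _*ℚ_; _≤_ to _≤ℚ_; _<_ to _<ℚ_)
import Data.Rational.Properties as ℚP
open import Data.Rational.Unnormalised as ℚᵘ using (mkℚᵘ; *≡*) renaming (_≃_ to _≃ᵘ_)
import Data.Rational.Unnormalised.Properties as ℚᵘP
open import Data.Sum using (_⊎_; inj₁; inj₂)
open import Defs
open import Function using (_∘_)
open import Level using (0ℓ)
open import Relation.Binary.PropositionalEquality
open import Relation.Nullary using (Dec; yes; no; does; contradiction; dec⇒maybe)
open import Relation.Nullary.Decidable using (_×-dec_; ¬?; dec-true)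
open import Tactic.RingSolver using (solve-∀)
open import Tactic.RingSolver.Core.AlmostCommutativeRing using (AlmostCommutativeRing; fromCommutativeRing)

≤-foldr-⊔ : ∀ {x xs} → x ∈ xs → x ≤ foldr _⊔_ 0 xs
≤-foldr-⊔ {x} x∈xs = foldr-preservesᵒ {P = x ≤_} ≤-⊔ 0 _ (inj₂ (Any.map ℕP.≤-reflexive x∈xs))
  where
  ≤-⊔ : ∀ m n → x ≤ m ⊎ x ≤ n → x ≤ m ⊔ n
  ≤-⊔ m n (inj₁ x≤m) = ℕP.m≤n⇒m≤n⊔o n x≤m
  ≤-⊔ m n (inj₂ x≤n) = ℕP.m≤n⇒m≤o⊔n m x≤n

prime∤⇒coprime : ∀ {p n} → Prime p → p ∤ n → Coprime n p
prime∤⇒coprime pp p∤n {i} (i∣n , i∣p) with prime⇒irreducible pp i∣p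
... | inj₁ i≡1  = i≡1
... | inj₂ refl = contradiction i∣n p∤n

2∤1+2n : ∀ n → 2 ∤ suc (2 * n)
2∤1+2n n (divides q 1+2n≡q*2) = ℕP.even≢odd q n (sym (trans 1+2n≡q*2 (ℕP.*-comm q 2)))

module _ (k : ℕ) where

  oddDivisorOrZero : ℕ → ℕ
  oddDivisorOrZero d = if does (d ∣? k ×-dec ¬? (2 ∣? d)) then d else 0

  oddDivisorOrZero-≡ : ∀ {d} → OddDivisor d k → oddDivisorOrZero d ≡ d
  oddDivisorOrZero-≡ {d} odd = cong (if_then d else 0) (dec-true (d ∣? k ×-dec ¬? (2 ∣? d)) odd)

  oddDivisorOrZero-cases : ∀ d →
    oddDivisorOrZero d ≡ 0 ⊎ (oddDivisorOrZero d ≡ d × OddDivisor d k)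
  oddDivisorOrZero-cases d = cases (d ∣? k ×-dec ¬? (2 ∣? d))
    where
    cases : ∀ {A : Set} (A? : Dec A) →
            (if does A? then d else 0) ≡ 0 ⊎ ((if does A? then d else 0) ≡ d × A)
    cases (yes a) = inj₂ (refl , a)
    cases (no _)  = inj₁ refl

α-greatest : ∀ {k d} .{{_ : NonZero k}} → OddDivisor d k → d ≤ α k
α-greatest {k} {zero}  _   = z≤n
α-greatest {k} {suc _} odd = subst (_≤ α k) (oddDivisorOrZero-≡ k odd)
  (≤-foldr-⊔ (∈-map⁺ (oddDivisorOrZero k) (∈-applyUpTo⁺ suc (∣⇒≤ (proj₁ odd)))))

α≢0 : ∀ k .{{_ : NonZero k}} → α k ≢ 0
α≢0 k = ℕP.m<n⇒n≢0 (α-greatest (1∣ k , 2∤1+2n 0))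

α-oddDivisor : ∀ k .{{_ : NonZero k}} → OddDivisor (α k) k
α-oddDivisor k with foldr-selective ℕP.⊔-sel 0 (map (oddDivisorOrZero k) (applyUpTo suc k))
... | inj₁ α≡0 = contradiction α≡0 (α≢0 k)
... | inj₂ α∈xs with ∈-map⁻ (oddDivisorOrZero k) α∈xs
...   | d , _ , α≡f[d] with oddDivisorOrZero-cases k d
...     | inj₁ f[d]≡0         = contradiction (trans α≡f[d] f[d]≡0) (α≢0 k)
...     | inj₂ (f[d]≡d , odd) = subst (λ x → OddDivisor x k) (sym (trans α≡f[d] f[d]≡d)) odd

α-odd : ∀ {k} .{{_ : NonZero k}} → 2 ∤ k → α k ≡ k
α-odd {k} 2∤k = ℕP.≤-antisym (∣⇒≤ (proj₁ (α-oddDivisor k))) (α-greatest (∣-refl , 2∤k))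

α-double : ∀ m → α (2 * m) ≡ α m
α-double zero      = refl
α-double m@(suc _) with α-oddDivisor m | α-oddDivisor (2 * m)
... | α[m]∣m , 2∤α[m] | α[2m]∣2m , 2∤α[2m] = ℕP.≤-antisym
  (α-greatest (coprime-divisor (prime∤⇒coprime prime[2] 2∤α[2m]) α[2m]∣2m , 2∤α[2m]))
  (α-greatest (∣-trans α[m]∣m (n∣m*n 2) , 2∤α[m]))

ℚ-ring : AlmostCommutativeRing 0ℓ 0ℓ
ℚ-ring = fromCommutativeRing ℚP.+-*-commutativeRing (λ x → dec⇒maybe (0ℚ ℚP.≟ x))

toℚᵘ-÷ : ∀ a d .{{_ : NonZero d}} → toℚᵘ (+ a ÷ d) ≃ᵘ mkℚᵘ (+ a) (ℕ.pred d)
toℚᵘ-÷ a (suc d) = ℚP.toℚᵘ-fromℚᵘ (mkℚᵘ (+ a) d)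

÷-cross : ∀ a b d e .{{_ : NonZero d}} .{{_ : NonZero e}} → a * e ≡ b * d → + a ÷ d ≡ + b ÷ e
÷-cross a b d@(suc _) e@(suc _) ae≡bd = ℚP.toℚᵘ-injective
  (ℚᵘP.≃-trans (toℚᵘ-÷ a d) (ℚᵘP.≃-trans (*≡* ae≡bd-in-ℤ) (ℚᵘP.≃-sym (toℚᵘ-÷ b e))))
  where
  ae≡bd-in-ℤ : + a ℤ.* + e ≡ + b ℤ.* + d
  ae≡bd-in-ℤ = trans (sym (ℤP.pos-* a e)) (trans (cong +_ ae≡bd) (ℤP.pos-* b d))

÷-+-÷ : ∀ a b d e .{{_ : NonZero d}} .{{_ : NonZero e}} →
        + a ÷ d +ℚ + b ÷ e ≡ _÷_ (+ (a * e + b * d)) (d * e) {{ℕP.m*n≢0 d e}}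
÷-+-÷ a b d@(suc _) e@(suc _) = ℚP.toℚᵘ-injective
  (ℚᵘP.≃-trans (ℚP.toℚᵘ-homo-+ (+ a ÷ d) (+ b ÷ e))
  (ℚᵘP.≃-trans (ℚᵘP.+-cong (toℚᵘ-÷ a d) (toℚᵘ-÷ b e))
  (ℚᵘP.≃-trans (*≡* (cong (ℤ._* + (d * e)) sum-in-ℤ))
  (ℚᵘP.≃-sym (toℚᵘ-÷ (a * e + b * d) (d * e))))))
  where
  sum-in-ℤ : + a ℤ.* + e ℤ.+ + b ℤ.* + d ≡ + (a * e + b * d)
  sum-in-ℤ = sym (trans (ℤP.pos-+ (a * e) (b * d)) (cong₂ ℤ._+_ (ℤP.pos-* a e) (ℤP.pos-* b d)))

÷-*-÷ : ∀ a b d e .{{_ : NonZero d}} .{{_ : NonZero e}} →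
        (+ a ÷ d) *ℚ (+ b ÷ e) ≡ _÷_ (+ (a * b)) (d * e) {{ℕP.m*n≢0 d e}}
÷-*-÷ a b d@(suc _) e@(suc _) = ℚP.toℚᵘ-injective
  (ℚᵘP.≃-trans (ℚP.toℚᵘ-homo-* (+ a ÷ d) (+ b ÷ e))
  (ℚᵘP.≃-trans (ℚᵘP.*-cong (toℚᵘ-÷ a d) (toℚᵘ-÷ b e))
  (ℚᵘP.≃-trans (*≡* (cong (ℤ._* + (d * e)) (sym (ℤP.pos-* a b))))
  (ℚᵘP.≃-sym (toℚᵘ-÷ (a * b) (d * e))))))

fromℕ : ℕ → ℚ
fromℕ n = + n ÷ 1

⅓ ⅔ : ℚ
⅓ = + 1 ÷ 3
⅔ = + 2 ÷ 3

fromℕ-+ : ∀ m n → fromℕ (m + n) ≡ fromℕ m +ℚ fromℕ n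
fromℕ-+ m n = sym (trans (÷-+-÷ m n 1 1)
  (÷-cross (m * 1 + n * 1) (m + n) (1 * 1) 1 (ℕ-Solver.solve (m ∷ n ∷ []))))

fromℕ-2* : ∀ n → fromℕ (2 * n) ≡ fromℕ n +ℚ fromℕ n
fromℕ-2* n = trans (fromℕ-+ n (n + 0)) (cong (λ m → fromℕ n +ℚ fromℕ m) (ℕP.+-identityʳ n))

n÷n≡1 : ∀ n .{{_ : NonZero n}} → + n ÷ n ≡ 1ℚ
n÷n≡1 n = ÷-cross n 1 n 1 (ℕP.*-comm n 1)

÷≡fromℕ*1÷ : ∀ a d .{{_ : NonZero d}} → + a ÷ d ≡ fromℕ a *ℚ (+ 1 ÷ d)
÷≡fromℕ*1÷ a d = sym (trans (÷-*-÷ a 1 1 d)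
  (÷-cross (a * 1) a (1 * d) d {{ℕP.m*n≢0 1 d}} (ℕ-Solver.solve (a ∷ d ∷ []))))

÷-2* : ∀ a d .{{_ : NonZero d}} → _÷_ (+ a) (2 * d) {{ℕP.m*n≢0 2 d}} ≡ ½ *ℚ (+ a ÷ d)
÷-2* a d = sym (trans (÷-*-÷ 1 a 2 d)
  (÷-cross (1 * a) a (2 * d) (2 * d) {{2d≢0}} {{2d≢0}} (ℕ-Solver.solve (a ∷ d ∷ []))))
  where
  2d≢0 : NonZero (2 * d)
  2d≢0 = ℕP.m*n≢0 2 d

α[1+2n]÷[1+2n]≡1 : ∀ n → + α (suc (2 * n)) ÷ suc (2 * n) ≡ 1ℚ
α[1+2n]÷[1+2n]≡1 n =
  trans (cong (λ a → + a ÷ suc (2 * n)) (α-odd (2∤1+2n n))) (n÷n≡1 (suc (2 * n)))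

α[2+2n]÷[2+2n]≡½α[1+n]÷[1+n] : ∀ n →
  + α (suc (suc (2 * n))) ÷ suc (suc (2 * n)) ≡ ½ *ℚ (+ α (suc n) ÷ suc n)
α[2+2n]÷[2+2n]≡½α[1+n]÷[1+n] n = begin
  + α (suc (suc (2 * n))) ÷ suc (suc (2 * n)) ≡⟨ ℚP./-cong (cong (+_ ∘ α) 2+2n≡2[1+n]) 2+2n≡2[1+n] ⟩
  + α (2 * suc n) ÷ (2 * suc n)               ≡⟨ cong (λ a → + a ÷ (2 * suc n)) (α-double (suc n)) ⟩
  + α (suc n) ÷ (2 * suc n)                   ≡⟨ ÷-2* (α (suc n)) (suc n) ⟩
  ½ *ℚ (+ α (suc n) ÷ suc n)                  ∎
  where
  open ≡-Reasoning
  2+2n≡2[1+n] : suc (suc (2 * n)) ≡ 2 * suc n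
  2+2n≡2[1+n] = sym (ℕP.*-suc 2 n)

V-double : ∀ n → V (2 * n) ≡ fromℕ n +ℚ ½ *ℚ V n
V-double zero    = refl
V-double (suc n) = begin
  V (2 * suc n)                                     ≡⟨ cong V (ℕP.*-suc 2 n) ⟩
  V (2 * n) +ℚ + α (suc (2 * n)) ÷ suc (2 * n)
            +ℚ + α (suc (suc (2 * n))) ÷ suc (suc (2 * n))
    ≡⟨ cong₂ _+ℚ_ (cong₂ _+ℚ_ (V-double n) (α[1+2n]÷[1+2n]≡1 n))
                  (α[2+2n]÷[2+2n]≡½α[1+n]÷[1+n] n) ⟩
  fromℕ n +ℚ ½ *ℚ V n +ℚ 1ℚ +ℚ ½ *ℚ t               ≡⟨ regroup (fromℕ n) (V n) t ⟩
  (1ℚ +ℚ fromℕ n) +ℚ ½ *ℚ (V n +ℚ t)                 ≡⟨ cong (_+ℚ ½ *ℚ V (suc n)) (fromℕ-+ 1 n) ⟨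
  fromℕ (suc n) +ℚ ½ *ℚ V (suc n)                    ∎
  where
  open ≡-Reasoning
  t : ℚ
  t = + α (suc n) ÷ suc n
  regroup : ∀ x w t → x +ℚ ½ *ℚ w +ℚ 1ℚ +ℚ ½ *ℚ t ≡ (1ℚ +ℚ x) +ℚ ½ *ℚ (w +ℚ t)
  regroup = solve-∀ ℚ-ring

v≡V-n⅔ : ∀ n → v n ≡ V n - fromℕ n *ℚ ⅔
v≡V-n⅔ zero    = refl
v≡V-n⅔ (suc n) = cong (V (suc n) -_) (sym (trans (÷-*-÷ (suc n) 2 1 3)
  (÷-cross (suc n * 2) (2 * suc n) (1 * 3) 3 (ℕ-Solver.solve (n ∷ [])))))

v-double : ∀ n → v (2 * n) ≡ ½ *ℚ v n
v-double n = begin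
  v (2 * n)                                          ≡⟨ v≡V-n⅔ (2 * n) ⟩
  V (2 * n) - fromℕ (2 * n) *ℚ ⅔
    ≡⟨ cong₂ (λ x y → x - y *ℚ ⅔) (V-double n) (fromℕ-2* n) ⟩
  (fromℕ n +ℚ ½ *ℚ V n) - (fromℕ n +ℚ fromℕ n) *ℚ ⅔ ≡⟨ regroup (fromℕ n) (V n) ⟩
  ½ *ℚ (V n - fromℕ n *ℚ ⅔)                          ≡⟨ cong (½ *ℚ_) (v≡V-n⅔ n) ⟨
  ½ *ℚ v n                                           ∎
  where
  open ≡-Reasoning
  regroup : ∀ x w → (x +ℚ ½ *ℚ w) - (x +ℚ x) *ℚ ⅔ ≡ ½ *ℚ (w - x *ℚ ⅔)
  regroup = solve-∀ ℚ-ring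

v-double-suc : ∀ n → v (suc (2 * n)) ≡ ⅓ +ℚ ½ *ℚ v n
v-double-suc n = begin
  v (suc (2 * n))                 ≡⟨ v≡V-n⅔ (suc (2 * n)) ⟩
  V (2 * n) +ℚ + α (suc (2 * n)) ÷ suc (2 * n) - fromℕ (1 + 2 * n) *ℚ ⅔
    ≡⟨ cong₂ (λ x y → x - y *ℚ ⅔) (cong₂ _+ℚ_ (V-double n) (α[1+2n]÷[1+2n]≡1 n)) fromℕ[1+2n]≡ ⟩
  fromℕ n +ℚ ½ *ℚ V n +ℚ 1ℚ - (1ℚ +ℚ (fromℕ n +ℚ fromℕ n)) *ℚ ⅔
    ≡⟨ regroup (fromℕ n) (V n) ⟩
  ⅓ +ℚ ½ *ℚ (V n - fromℕ n *ℚ ⅔)  ≡⟨ cong (λ x → ⅓ +ℚ ½ *ℚ x) (v≡V-n⅔ n) ⟨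
  ⅓ +ℚ ½ *ℚ v n                   ∎
  where
  open ≡-Reasoning
  fromℕ[1+2n]≡ : fromℕ (1 + 2 * n) ≡ 1ℚ +ℚ (fromℕ n +ℚ fromℕ n)
  fromℕ[1+2n]≡ = trans (fromℕ-+ 1 (2 * n)) (cong (1ℚ +ℚ_) (fromℕ-2* n))
  regroup : ∀ x w →
    x +ℚ ½ *ℚ w +ℚ 1ℚ - (1ℚ +ℚ (x +ℚ x)) *ℚ ⅔ ≡ ⅓ +ℚ ½ *ℚ (w - x *ℚ ⅔)
  regroup = solve-∀ ℚ-ring

v-digit : ∀ {e} n → e ≤ 1 → v (e + 2 * n) ≡ + e ÷ 3 +ℚ ½ *ℚ v n
v-digit {0}           n _        = trans (v-double n) (sym (ℚP.+-identityˡ (½ *ℚ v n)))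
v-digit {1}           n _        = v-double-suc n
v-digit {suc (suc _)} _ (s≤s ())

IsBinary : ℕ → (ℕ → ℕ) → Set
IsBinary m ε = ∀ k → k < m → ε k ≤ 1

IsBinary-head : ∀ {m ε} → IsBinary (suc m) ε → ε 0 ≤ 1
IsBinary-head bits = bits 0 (s≤s z≤n)

IsBinary-tail : ∀ {m ε} → IsBinary (suc m) ε → IsBinary m (ε ∘ suc)
IsBinary-tail bits k k<m = bits (suc k) (s≤s k<m)

fromBits : ℕ → (ℕ → ℕ) → ℕ
fromBits m ε = Σ<ℕ m (λ k → ε k * 2 ^ k)

_÷2^_ : ℕ → ℕ → ℚ
a ÷2^ k = _÷_ (+ a) (2 ^ k) {{m^n≢0 2 k}}

⌊_/2^_⌋ : ℕ → ℕ → ℕ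
⌊ n /2^ p ⌋ = _/_ n (2 ^ p) {{m^n≢0 2 p}}

Σ<ℕ-cong : ∀ m {f g} → (∀ k → f k ≡ g k) → Σ<ℕ m f ≡ Σ<ℕ m g
Σ<ℕ-cong zero    f≗g = refl
Σ<ℕ-cong (suc m) f≗g = cong₂ _+_ (Σ<ℕ-cong m f≗g) (f≗g m)

Σ<ℚ-cong : ∀ m {f g} → (∀ k → f k ≡ g k) → Σ<ℚ m f ≡ Σ<ℚ m g
Σ<ℚ-cong zero    f≗g = refl
Σ<ℚ-cong (suc m) f≗g = cong₂ _+ℚ_ (Σ<ℚ-cong m f≗g) (f≗g m)

Σ<ℕ-peel : ∀ m f → Σ<ℕ (suc m) f ≡ f 0 + Σ<ℕ m (f ∘ suc)
Σ<ℕ-peel zero    f = ℕP.+-comm 0 (f 0)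
Σ<ℕ-peel (suc m) f = trans (cong (_+ f (suc m)) (Σ<ℕ-peel m f)) (ℕP.+-assoc (f 0) _ (f (suc m)))

Σ<ℚ-peel : ∀ m f → Σ<ℚ (suc m) f ≡ f 0 +ℚ Σ<ℚ m (f ∘ suc)
Σ<ℚ-peel zero    f = ℚP.+-comm 0ℚ (f 0)
Σ<ℚ-peel (suc m) f = trans (cong (_+ℚ f (suc m)) (Σ<ℚ-peel m f)) (ℚP.+-assoc (f 0) _ (f (suc m)))

Σ<ℕ-*ˡ : ∀ m c f → Σ<ℕ m (λ k → c * f k) ≡ c * Σ<ℕ m f
Σ<ℕ-*ˡ zero    c f = sym (ℕP.*-zeroʳ c)
Σ<ℕ-*ˡ (suc m) c f = trans (cong (_+ c * f m) (Σ<ℕ-*ˡ m c f)) (sym (ℕP.*-distribˡ-+ c _ (f m)))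

Σ<ℚ-*ˡ : ∀ m c f → Σ<ℚ m (λ k → c *ℚ f k) ≡ c *ℚ Σ<ℚ m f
Σ<ℚ-*ˡ zero    c f = sym (ℚP.*-zeroʳ c)
Σ<ℚ-*ˡ (suc m) c f = trans (cong (_+ℚ c *ℚ f m) (Σ<ℚ-*ˡ m c f)) (sym (ℚP.*-distribˡ-+ c _ (f m)))

fromBits-suc : ∀ m ε → fromBits (suc m) ε ≡ ε 0 + 2 * fromBits m (ε ∘ suc)
fromBits-suc m ε = begin
  fromBits (suc m) ε                               ≡⟨ Σ<ℕ-peel m (λ k → ε k * 2 ^ k) ⟩
  ε 0 * 1 + Σ<ℕ m (λ k → ε (suc k) * (2 * 2 ^ k))
    ≡⟨ cong₂ _+_ (ℕP.*-identityʳ (ε 0)) (Σ<ℕ-cong m (λ k → *-2*-comm (ε (suc k)) (2 ^ k))) ⟩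
  ε 0 + Σ<ℕ m (λ k → 2 * (ε (suc k) * 2 ^ k))
    ≡⟨ cong (_+_ (ε 0)) (Σ<ℕ-*ˡ m 2 (λ k → ε (suc k) * 2 ^ k)) ⟩
  ε 0 + 2 * fromBits m (ε ∘ suc)                   ∎
  where
  open ≡-Reasoning
  *-2*-comm : ∀ e x → e * (2 * x) ≡ 2 * (e * x)
  *-2*-comm = ℕ-Solver.solve-∀

2^[1+m]+fromBits-suc : ∀ m ε →
  2 ^ suc m + fromBits (suc m) ε ≡ ε 0 + 2 * (2 ^ m + fromBits m (ε ∘ suc))
2^[1+m]+fromBits-suc m ε =
  trans (cong (_+_ (2 ^ suc m)) (fromBits-suc m ε)) (regroup (2 ^ m) (ε 0) (fromBits m (ε ∘ suc)))
  where
  regroup : ∀ t e b → 2 * t + (e + 2 * b) ≡ e + 2 * (t + b)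
  regroup = ℕ-Solver.solve-∀

Σ<ℚ-÷2^-peel : ∀ m (ε : ℕ → ℕ) →
  Σ<ℚ (suc m) (λ k → ε k ÷2^ k) ≡ fromℕ (ε 0) +ℚ ½ *ℚ Σ<ℚ m (λ k → ε (suc k) ÷2^ k)
Σ<ℚ-÷2^-peel m ε = trans (Σ<ℚ-peel m (λ k → ε k ÷2^ k)) (cong (fromℕ (ε 0) +ℚ_)
  (trans (Σ<ℚ-cong m (λ k → ÷-2* (ε (suc k)) (2 ^ k) {{m^n≢0 2 k}}))
         (Σ<ℚ-*ˡ m ½ (λ k → ε (suc k) ÷2^ k))))

v-fromBits : ∀ m ε → IsBinary m ε → v (fromBits m ε) ≡ ⅓ *ℚ Σ<ℚ m (λ k → ε k ÷2^ k)
v-fromBits zero    ε bits = refl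
v-fromBits (suc m) ε bits = begin
  v (fromBits (suc m) ε)                        ≡⟨ cong v (fromBits-suc m ε) ⟩
  v (ε 0 + 2 * fromBits m (ε ∘ suc))            ≡⟨ v-digit (fromBits m (ε ∘ suc)) (IsBinary-head bits) ⟩
  + ε 0 ÷ 3 +ℚ ½ *ℚ v (fromBits m (ε ∘ suc))
    ≡⟨ cong₂ (λ x y → x +ℚ ½ *ℚ y) (÷≡fromℕ*1÷ (ε 0) 3)
             (v-fromBits m (ε ∘ suc) (IsBinary-tail bits)) ⟩
  fromℕ (ε 0) *ℚ ⅓ +ℚ ½ *ℚ (⅓ *ℚ S)             ≡⟨ regroup (fromℕ (ε 0)) S ⟩
  ⅓ *ℚ (fromℕ (ε 0) +ℚ ½ *ℚ S)                  ≡⟨ cong (⅓ *ℚ_) (Σ<ℚ-÷2^-peel m ε) ⟨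
  ⅓ *ℚ Σ<ℚ (suc m) (λ k → ε k ÷2^ k)            ∎
  where
  open ≡-Reasoning
  S : ℚ
  S = Σ<ℚ m (λ k → ε (suc k) ÷2^ k)
  regroup : ∀ x s → x *ℚ ⅓ +ℚ ½ *ℚ (⅓ *ℚ s) ≡ ⅓ *ℚ (x +ℚ ½ *ℚ s)
  regroup = solve-∀ ℚ-ring

[e+2n]/2≡n : ∀ {e} n → e ≤ 1 → (e + 2 * n) / 2 ≡ n
[e+2n]/2≡n {e} n e≤1 = begin
  (e + 2 * n) / 2    ≡⟨ DM.+-distrib-/-∣ʳ e (m∣m*n n) ⟩
  e / 2 + 2 * n / 2  ≡⟨ cong₂ _+_ (DM.m<n⇒m/n≡0 (s≤s e≤1)) 2n/2≡n ⟩
  n                  ∎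
  where
  open ≡-Reasoning
  2n/2≡n : 2 * n / 2 ≡ n
  2n/2≡n = trans (cong (_/ 2) (ℕP.*-comm 2 n)) (DM.m*n/n≡m n 2)

⌊[e+2n]/2^[1+p]⌋ : ∀ {e} n p → e ≤ 1 → ⌊ e + 2 * n /2^ suc p ⌋ ≡ ⌊ n /2^ p ⌋
⌊[e+2n]/2^[1+p]⌋ {e} n p e≤1 = trans
  (sym (DM.m/n/o≡m/[n*o] (e + 2 * n) 2 (2 ^ p) {{_}} {{m^n≢0 2 p}} {{m^n≢0 2 (suc p)}}))
  (cong (λ m → ⌊ m /2^ p ⌋) ([e+2n]/2≡n n e≤1))

Σv⌊/2^⌋-peel : ∀ {e} n m → e ≤ 1 →
  Σ<ℚ (suc m) (λ p → v ⌊ e + 2 * n /2^ p ⌋) ≡ v (e + 2 * n) +ℚ Σ<ℚ m (λ p → v ⌊ n /2^ p ⌋)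
Σv⌊/2^⌋-peel {e} n m e≤1 = trans (Σ<ℚ-peel m (λ p → v ⌊ e + 2 * n /2^ p ⌋))
  (cong₂ _+ℚ_ (cong v (DM.n/1≡n (e + 2 * n))) (Σ<ℚ-cong m (λ p → cong v (⌊[e+2n]/2^[1+p]⌋ n p e≤1))))

v+Σv⌊/2^⌋ : ∀ m ε → IsBinary m ε →
  v (fromBits m ε) +ℚ Σ<ℚ m (λ p → v ⌊ fromBits m ε /2^ p ⌋) ≡ ⅔ *ℚ fromℕ (Σ<ℕ m ε)
v+Σv⌊/2^⌋ zero    ε bits = refl
v+Σv⌊/2^⌋ (suc m) ε bits = begin
  v (fromBits (suc m) ε) +ℚ Σ<ℚ (suc m) (λ p → v ⌊ fromBits (suc m) ε /2^ p ⌋)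
    ≡⟨ cong (λ n → v n +ℚ Σ<ℚ (suc m) (λ p → v ⌊ n /2^ p ⌋)) (fromBits-suc m ε) ⟩
  v n +ℚ Σ<ℚ (suc m) (λ p → v ⌊ n /2^ p ⌋)        ≡⟨ cong (v n +ℚ_) (Σv⌊/2^⌋-peel N m e≤1) ⟩
  v n +ℚ (v n +ℚ T)                               ≡⟨ cong (λ x → x +ℚ (x +ℚ T)) v[n]≡ ⟩
  x +ℚ (x +ℚ T)                                   ≡⟨ regroup (fromℕ (ε 0)) (v N) T ⟩
  ⅔ *ℚ fromℕ (ε 0) +ℚ (v N +ℚ T)
    ≡⟨ cong (⅔ *ℚ fromℕ (ε 0) +ℚ_) (v+Σv⌊/2^⌋ m (ε ∘ suc) (IsBinary-tail bits)) ⟩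
  ⅔ *ℚ fromℕ (ε 0) +ℚ ⅔ *ℚ fromℕ (Σ<ℕ m (ε ∘ suc)) ≡⟨ ℚP.*-distribˡ-+ ⅔ (fromℕ (ε 0)) _ ⟨
  ⅔ *ℚ (fromℕ (ε 0) +ℚ fromℕ (Σ<ℕ m (ε ∘ suc)))
    ≡⟨ cong (⅔ *ℚ_) (trans (cong fromℕ (Σ<ℕ-peel m ε)) (fromℕ-+ (ε 0) _)) ⟨
  ⅔ *ℚ fromℕ (Σ<ℕ (suc m) ε)                      ∎
  where
  open ≡-Reasoning
  e≤1 : ε 0 ≤ 1
  e≤1 = IsBinary-head bits
  N n : ℕ
  N = fromBits m (ε ∘ suc)
  n = ε 0 + 2 * N
  T x : ℚ
  T = Σ<ℚ m (λ p → v ⌊ N /2^ p ⌋)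
  x = fromℕ (ε 0) *ℚ ⅓ +ℚ ½ *ℚ v N
  v[n]≡ : v n ≡ x
  v[n]≡ = trans (v-digit N e≤1) (cong (_+ℚ ½ *ℚ v N) (÷≡fromℕ*1÷ (ε 0) 3))
  regroup : ∀ e w t →
    (e *ℚ ⅓ +ℚ ½ *ℚ w) +ℚ ((e *ℚ ⅓ +ℚ ½ *ℚ w) +ℚ t) ≡ ⅔ *ℚ e +ℚ (w +ℚ t)
  regroup = solve-∀ ℚ-ring

e÷3+[1∸e]÷3≡⅓ : ∀ {e} → e ≤ 1 → + e ÷ 3 +ℚ + (1 ∸ e) ÷ 3 ≡ ⅓
e÷3+[1∸e]÷3≡⅓ {0}           _        = refl
e÷3+[1∸e]÷3≡⅓ {1}           _        = refl
e÷3+[1∸e]÷3≡⅓ {suc (suc _)} (s≤s ())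

v-complement : ∀ m ε → IsBinary m ε →
  v (2 ^ m + fromBits m ε) +ℚ v (2 ^ m + fromBits m (λ k → 1 ∸ ε k)) ≡ ⅔
v-complement zero    ε bits = refl
v-complement (suc m) ε bits = begin
  v (2 ^ suc m + fromBits (suc m) ε) +ℚ v (2 ^ suc m + fromBits (suc m) ε̂)
    ≡⟨ cong₂ (λ x y → v x +ℚ v y) (2^[1+m]+fromBits-suc m ε) (2^[1+m]+fromBits-suc m ε̂) ⟩
  v (ε 0 + 2 * X) +ℚ v (ε̂ 0 + 2 * Y)
    ≡⟨ cong₂ _+ℚ_ (v-digit X e≤1) (v-digit Y (ℕP.m∸n≤m 1 (ε 0))) ⟩
  (+ ε 0 ÷ 3 +ℚ ½ *ℚ v X) +ℚ (+ ε̂ 0 ÷ 3 +ℚ ½ *ℚ v Y)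
    ≡⟨ regroup (+ ε 0 ÷ 3) (v X) (+ ε̂ 0 ÷ 3) (v Y) ⟩
  (+ ε 0 ÷ 3 +ℚ + ε̂ 0 ÷ 3) +ℚ ½ *ℚ (v X +ℚ v Y)
    ≡⟨ cong₂ (λ x y → x +ℚ ½ *ℚ y) (e÷3+[1∸e]÷3≡⅓ e≤1)
             (v-complement m (ε ∘ suc) (IsBinary-tail bits)) ⟩
  ⅓ +ℚ ½ *ℚ ⅔                                     ≡⟨⟩
  ⅔                                               ∎
  where
  open ≡-Reasoning
  ε̂ : ℕ → ℕ
  ε̂ k = 1 ∸ ε k
  e≤1 : ε 0 ≤ 1
  e≤1 = IsBinary-head bits
  X Y : ℕ
  X = 2 ^ m + fromBits m (ε ∘ suc)
  Y = 2 ^ m + fromBits m (ε̂ ∘ suc)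
  regroup : ∀ a x b y → (a +ℚ ½ *ℚ x) +ℚ (b +ℚ ½ *ℚ y) ≡ (a +ℚ b) +ℚ ½ *ℚ (x +ℚ y)
  regroup = solve-∀ ℚ-ring

e÷3-bounds : ∀ {e} → e ≤ 1 → 0ℚ ≤ℚ + e ÷ 3 × + e ÷ 3 ≤ℚ ⅓
e÷3-bounds {0}           _        = ℚP.≤-refl , *≤* (ℤ.+≤+ z≤n)
e÷3-bounds {1}           _        = *≤* (ℤ.+≤+ z≤n) , ℚP.≤-refl
e÷3-bounds {suc (suc _)} (s≤s ())

n≡n%2+2[n/2] : ∀ n → n ≡ n % 2 + 2 * (n / 2)
n≡n%2+2[n/2] n = trans (DM.m≡m%n+[m/n]*n n 2) (cong (_+_ (n % 2)) (ℕP.*-comm (n / 2) 2))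

v-bounds : ∀ n → 0ℚ ≤ℚ v n × v n ≤ℚ ⅔
v-bounds = <-rec (λ n → 0ℚ ≤ℚ v n × v n ≤ℚ ⅔) bounds
  where
  bounds : ∀ n → (∀ {m} → m < n → 0ℚ ≤ℚ v m × v m ≤ℚ ⅔) → 0ℚ ≤ℚ v n × v n ≤ℚ ⅔
  bounds zero      _   = ℚP.≤-refl , *≤* (ℤ.+≤+ z≤n)
  bounds n@(suc _) rec with rec (DM.m/n<m n 2 (s≤s (s≤s z≤n)))
  ... | 0≤v[n/2] , v[n/2]≤⅔ = subst (λ x → 0ℚ ≤ℚ x × x ≤ℚ ⅔) (sym v[n]≡)
    ( ℚP.+-mono-≤ (proj₁ (e÷3-bounds e≤1)) (ℚP.*-monoˡ-≤-nonNeg ½ 0≤v[n/2])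
    , ℚP.+-mono-≤ (proj₂ (e÷3-bounds e≤1)) (ℚP.*-monoˡ-≤-nonNeg ½ v[n/2]≤⅔))
    where
    e≤1 : n % 2 ≤ 1
    e≤1 = ℕP.≤-pred (DM.m%n<n n 2)
    v[n]≡ : v n ≡ + (n % 2) ÷ 3 +ℚ ½ *ℚ v (n / 2)
    v[n]≡ = trans (cong v (n≡n%2+2[n/2] n)) (v-digit (n / 2) e≤1)

gridPoint : ℕ → ℕ → ℚ
gridPoint K j = _÷_ (+ j) (3 * 2 ^ K) {{ℕP.m*n≢0 3 (2 ^ K) {{_}} {{m^n≢0 2 K}}}}

gridPoint-suc : ∀ K e r → gridPoint (suc K) (r + e * 2 ^ suc K) ≡ + e ÷ 3 +ℚ ½ *ℚ gridPoint K r
gridPoint-suc K e r = sym (begin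
  + e ÷ 3 +ℚ ½ *ℚ gridPoint K r            ≡⟨ cong (+ e ÷ 3 +ℚ_) (÷-2* r D) ⟨
  + e ÷ 3 +ℚ + r ÷ (2 * D)                 ≡⟨ ÷-+-÷ e r 3 (2 * D) ⟩
  + (e * (2 * D) + r * 3) ÷ (3 * (2 * D))
    ≡⟨ ÷-cross (e * (2 * D) + r * 3) (r + e * 2 ^ suc K) (3 * (2 * D)) (3 * 2 ^ suc K) (cross e r (2 ^ K)) ⟩
  gridPoint (suc K) (r + e * 2 ^ suc K)    ∎)
  where
  open ≡-Reasoning
  D : ℕ
  D = 3 * 2 ^ K
  instance
    D≢0 : NonZero D
    D≢0 = ℕP.m*n≢0 3 (2 ^ K) {{_}} {{m^n≢0 2 K}}
    2D≢0 : NonZero (2 * D)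
    2D≢0 = ℕP.m*n≢0 2 D
    6D≢0 : NonZero (3 * (2 * D))
    6D≢0 = ℕP.m*n≢0 3 (2 * D)
    D′≢0 : NonZero (3 * 2 ^ suc K)
    D′≢0 = ℕP.m*n≢0 3 (2 ^ suc K) {{_}} {{m^n≢0 2 (suc K)}}
  cross : ∀ e r t →
    (e * (2 * (3 * t)) + r * 3) * (3 * (2 * t)) ≡ (r + e * (2 * t)) * (3 * (2 * (3 * t)))
  cross = ℕ-Solver.solve-∀

-- The leading binary digit j / 2^(K+1) of j becomes the last binary digit of n.
gridPoint-attained : ∀ K j → j < 2 ^ suc K → ∃[ n ] v n ≡ gridPoint K j
gridPoint-attained zero    0             _              = 0 , refl
gridPoint-attained zero    1             _              = 1 , refl
gridPoint-attained zero    (suc (suc _)) (s≤s (s≤s ()))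
gridPoint-attained (suc K) j             j<2^[2+K] =
  let (n , v[n]≡) = gridPoint-attained K (j % P) (DM.m%n<n j P) in
  j / P + 2 * n , (begin
    v (j / P + 2 * n)                         ≡⟨ v-digit n e≤1 ⟩
    + (j / P) ÷ 3 +ℚ ½ *ℚ v n                 ≡⟨ cong (λ x → + (j / P) ÷ 3 +ℚ ½ *ℚ x) v[n]≡ ⟩
    + (j / P) ÷ 3 +ℚ ½ *ℚ gridPoint K (j % P) ≡⟨ gridPoint-suc K (j / P) (j % P) ⟨
    gridPoint (suc K) (j % P + j / P * P)     ≡⟨ cong (gridPoint (suc K)) (DM.m≡m%n+[m/n]*n j P) ⟨
    gridPoint (suc K) j                       ∎)
  where
  open ≡-Reasoning
  P : ℕ
  P = 2 ^ suc K
  instance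
    P≢0 : NonZero P
    P≢0 = m^n≢0 2 (suc K)
  e≤1 : j / P ≤ 1
  e≤1 = ℕP.≤-pred (DM.m<n*o⇒m/o<n {n = 2} j<2^[2+K])

n<2^n : ∀ n → n < 2 ^ n
n<2^n zero    = s≤s z≤n
n<2^n (suc n) = ℕP.+-mono-≤ (ℕP.m^n>0 2 n) (ℕP.≤-trans (n<2^n n) (ℕP.m≤m+n (2 ^ n) 0))

-- j = ⌊pN/q⌋ + 1 is the first multiple of 1/N beyond p/q; since 1/N < 1/(qs) ≤ r/s − p/q,
-- it stays below r/s.
fraction-between : ∀ p q r s N .{{_ : NonZero q}} → p * s < r * q → q * s < N →
                   ∃[ j ] (p * N < j * q × j * s < r * N)
fraction-between p q r s N ps<rq qs<N = j , pN<jq , ℕP.*-cancelʳ-< q (j * s) (r * N) jsq<rNq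
  where
  open ℕP.≤-Reasoning
  j : ℕ
  j = suc (p * N / q)
  pN<jq : p * N < j * q
  pN<jq = begin-strict
    p * N                      ≡⟨ DM.m≡m%n+[m/n]*n (p * N) q ⟩
    p * N % q + p * N / q * q  <⟨ ℕP.+-monoˡ-< (p * N / q * q) (DM.m%n<n (p * N) q) ⟩
    j * q                      ∎
  jsq<rNq : j * s * q < r * N * q
  jsq<rNq = begin-strict
    j * s * q                  ≡⟨ swap j s q ⟩
    j * q * s                  ≤⟨ ℕP.*-monoˡ-≤ s (ℕP.+-monoʳ-≤ q (DM.m/n*n≤m (p * N) q)) ⟩
    (q + p * N) * s            ≡⟨ expand q p N s ⟩
    q * s + p * s * N          <⟨ ℕP.+-monoˡ-< (p * s * N) qs<N ⟩
    suc (p * s) * N            ≤⟨ ℕP.*-monoˡ-≤ N ps<rq ⟩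
    r * q * N                  ≡⟨ swap r q N ⟩
    r * N * q                  ∎
    where
    swap : ∀ x y z → x * y * z ≡ x * z * y
    swap = ℕ-Solver.solve-∀
    expand : ∀ q p n s → (q + p * n) * s ≡ q * s + p * s * n
    expand = ℕ-Solver.solve-∀

ℕ<⇒ℤ< : ∀ a b c d → a * b < c * d → + a ℤ.* + b ℤ.< + c ℤ.* + d
ℕ<⇒ℤ< a b c d ab<cd = subst₂ ℤ._<_ (ℤP.pos-* a b) (ℤP.pos-* c d) (ℤ.+<+ ab<cd)

ℤ<⇒ℕ< : ∀ a b c d → + a ℤ.* + b ℤ.< + c ℤ.* + d → a * b < c * d
ℤ<⇒ℕ< a b c d ab<cd =
  ℤP.drop‿+<+ (subst₂ ℤ._<_ (sym (ℤP.pos-* a b)) (sym (ℤP.pos-* c d)) ab<cd)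

ℤ≤⇒ℕ≤ : ∀ a b c d → + a ℤ.* + b ℤ.≤ + c ℤ.* + d → a * b ≤ c * d
ℤ≤⇒ℕ≤ a b c d ab≤cd =
  ℤP.drop‿+≤+ (subst₂ ℤ._≤_ (sym (ℤP.pos-* a b)) (sym (ℤP.pos-* c d)) ab≤cd)

<-÷ : ∀ x j d .{{_ : NonZero d}} → ↥ x ℤ.* + d ℤ.< + j ℤ.* ↧ x → x <ℚ + j ÷ d
<-÷ (mkℚ _ _ _) j d@(suc _) x<j/d =
  ℚP.toℚᵘ-cancel-< (ℚᵘP.<-respʳ-≃ (ℚᵘP.≃-sym (toℚᵘ-÷ j d)) (ℚᵘ.*<* x<j/d))

÷-< : ∀ x j d .{{_ : NonZero d}} → + j ℤ.* ↧ x ℤ.< ↥ x ℤ.* + d → + j ÷ d <ℚ x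
÷-< (mkℚ _ _ _) j d@(suc _) j/d<x =
  ℚP.toℚᵘ-cancel-< (ℚᵘP.<-respˡ-≃ (ℚᵘP.≃-sym (toℚᵘ-÷ j d)) (ℚᵘ.*<* j/d<x))

gridPoint-between : ∀ {a b} → 0ℚ ≤ℚ a → 0ℚ <ℚ b → a <ℚ b → b ≤ℚ ⅔ →
                    ∃[ K ] ∃[ j ] (j < 2 ^ suc K × a <ℚ gridPoint K j × gridPoint K j <ℚ b)
gridPoint-between {mkℚ -[1+ _ ] _ _} (*≤* ()) _ _ _
gridPoint-between {mkℚ (+ _) _ _} {mkℚ -[1+ _ ] _ _} _ (*<* ()) _ _
gridPoint-between {a@(mkℚ (+ p) q-1 _)} {b@(mkℚ (+ r) s-1 _)} _ _ (*<* a<b) (*≤* b≤⅔) =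
  let (j , pN<jq , js<rN) = fraction-between p q r s N (ℤ<⇒ℕ< p s r q a<b) qs<N in
  K , j , j<2^[1+K] j js<rN , <-÷ a j N (ℕ<⇒ℤ< p N j q pN<jq) , ÷-< b j N (ℕ<⇒ℤ< j s r N js<rN)
  where
  q s K N : ℕ
  q = suc q-1
  s = suc s-1
  K = q * s
  N = 3 * 2 ^ K
  instance
    N≢0 : NonZero N
    N≢0 = ℕP.m*n≢0 3 (2 ^ K) {{_}} {{m^n≢0 2 K}}
  qs<N : q * s < N
  qs<N = ℕP.<-≤-trans (n<2^n K) (ℕP.m≤n*m (2 ^ K) 3)
  j<2^[1+K] : ∀ j → j * s < r * N → j < 2 ^ suc K
  j<2^[1+K] j js<rN = ℕP.*-cancelʳ-< (3 * s) j (2 ^ suc K) (begin-strict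
    j * (3 * s)          ≡⟨ *-3*-comm j s ⟩
    3 * (j * s)          <⟨ ℕP.*-monoʳ-< 3 js<rN ⟩
    3 * (r * N)          ≡⟨ 3*-*-comm r N ⟩
    r * 3 * N            ≤⟨ ℕP.*-monoˡ-≤ N (ℤ≤⇒ℕ≤ r 3 2 s b≤⅔) ⟩
    2 * s * N            ≡⟨ regroup s (2 ^ K) ⟩
    2 ^ suc K * (3 * s)  ∎)
    where
    open ℕP.≤-Reasoning
    *-3*-comm : ∀ x y → x * (3 * y) ≡ 3 * (x * y)
    *-3*-comm = ℕ-Solver.solve-∀
    3*-*-comm : ∀ x y → 3 * (x * y) ≡ x * 3 * y
    3*-*-comm = ℕ-Solver.solve-∀
    regroup : ∀ s t → 2 * s * (3 * t) ≡ 2 * t * (3 * s)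
    regroup = ℕ-Solver.solve-∀

0≤a<v[n]⇒1≤n : ∀ {a} n → 0ℚ ≤ℚ a → a <ℚ v n → 1 ≤ n
0≤a<v[n]⇒1≤n zero    0≤a a<v[0] = contradiction (ℚP.≤-<-trans 0≤a a<v[0]) (ℚP.<-irrefl refl)
0≤a<v[n]⇒1≤n (suc _) _   _      = s≤s z≤n

v-dense : ∀ {a b} → 0ℚ ≤ℚ a → a <ℚ b → b ≤ℚ ⅔ → ∃[ n ] (1 ≤ n × a <ℚ v n × v n <ℚ b)
v-dense {a} {b} 0≤a a<b b≤⅔ =
  let (K , j , j<2^[1+K] , a<g , g<b) = gridPoint-between 0≤a (ℚP.≤-<-trans 0≤a a<b) a<b b≤⅔
      (n , v[n]≡g) = gridPoint-attained K j j<2^[1+K]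
      a<v[n] = subst (a <ℚ_) (sym v[n]≡g) a<g
  in n , 0≤a<v[n]⇒1≤n n 0≤a a<v[n] , a<v[n] , subst (_<ℚ b) (sym v[n]≡g) g<b

proposition2 :
  -- (a)
  (∀ (n : ℕ) → 1 ℕ.≤ n →
     (v (2 * n) ≡ ½ *ℚ v n) × (v (2 * n + 1) ≡ (+ 1 ÷ 3) +ℚ ½ *ℚ v n))
  ×
  -- (b) binary-expansion formula
  (∀ (m : ℕ) (ε : ℕ → ℕ) → (∀ k → k ℕ.≤ m → ε k ℕ.≤ 1) →
     v (Σ<ℕ (ℕ.suc m) (λ k → ε k * 2 ^ k))
       ≡ (+ 1 ÷ 3) *ℚ Σ<ℚ (ℕ.suc m) (λ k → _÷_ (+ ε k) (2 ^ k) {{m^n≢0 2 k}}))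
  ×
  -- (b) in particular: {v n : n ≥ 1} ⊆ [0, 2/3] ...
  (∀ (n : ℕ) → 1 ℕ.≤ n → (0ℚ ≤ℚ v n) × (v n ≤ℚ + 2 ÷ 3))
  ×
  -- ... and it is dense in [0, 2/3]
  (∀ (a b : ℚ) → 0ℚ ≤ℚ a → a <ℚ b → b ≤ℚ + 2 ÷ 3 →
     ∃[ n ] (1 ℕ.≤ n × a <ℚ v n × v n <ℚ b))
  ×
  -- (c)
  (∀ (m : ℕ) (ε : ℕ → ℕ) → (∀ k → k ℕ.≤ m → ε k ℕ.≤ 1) →
     let n = Σ<ℕ (ℕ.suc m) (λ k → ε k * 2 ^ k) in
     v n +ℚ Σ<ℚ (ℕ.suc m) (λ p → v (_/_ n (2 ^ p) {{m^n≢0 2 p}}))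
       ≡ (+ 2 ÷ 3) *ℚ (+ Σ<ℕ (ℕ.suc m) ε ÷ 1))
  ×
  -- (d) symmetry
  (∀ (m : ℕ) (ε : ℕ → ℕ) → (∀ k → k ℕ.< m → ε k ℕ.≤ 1) →
     v (2 ^ m + Σ<ℕ m (λ k → ε k * 2 ^ k))
       +ℚ v (2 ^ m + Σ<ℕ m (λ k → (1 ∸ ε k) * 2 ^ k))
       ≡ + 2 ÷ 3)
proposition2 =
    (λ n _ → v-double n , v[2n+1]≡ n)
  , (λ m ε bits → v-fromBits (suc m) ε (IsBinary-≤ bits))
  , (λ n _ → v-bounds n)
  , (λ _ _ → v-dense)
  , (λ m ε bits → v+Σv⌊/2^⌋ (suc m) ε (IsBinary-≤ bits))
  , v-complement
  where
  v[2n+1]≡ : ∀ n → v (2 * n + 1) ≡ ⅓ +ℚ ½ *ℚ v n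
  v[2n+1]≡ n = trans (cong v (ℕP.+-comm (2 * n) 1)) (v-double-suc n)
  IsBinary-≤ : ∀ {m ε} → (∀ k → k ≤ m → ε k ≤ 1) → IsBinary (suc m) ε
  IsBinary-≤ bits k k<1+m = bits k (ℕP.≤-pred k<1+m)
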